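{- Let $(u_n)_{n\ge1}$ and $(v_n)_{n\ge1}$ be sequences of positive integers and $(\alpha_n)_{n\ge1}$ an arbitrary sequence of positive integers, with $u_1,m\in\mathbb Z_{>0}$ arbitrary. Suppose that either (i) $u_{n+2}u_n=\alpha_nu_{n+1}^3v_{n+1}$ for all $n\ge1$, with $u_2=mu_1^2v_1$; or (ii) $u_{n+2}=\alpha_nu_{n+1}^2v_n$ for all $n\ge1$, with $u_2=mu_1$. Define $x_1=u_1$ and $x_j=u_j\prod_{k=1}^{j-1}u_kv_k$ for $j\ge2$. Then $(x_n)$ has the strong Engel property: $z_j=x_j/x_{j-1}^2\in\mathbb Z$ for all $j\ge2$. -}

module Defs where

open import Data.Nat using (ℕ; zero; suc; _*_; _^_; _≤_; _<_)
open import Data.Nat.Divisibility using (_∣_)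
open import Data.Product using (_×_)
open import Data.Sum using (_⊎_)

-- Sequences indexed from 1 are modelled as functions ℕ → ℕ; the value at 0 is ignored.

prodUV : (ℕ → ℕ) → (ℕ → ℕ) → ℕ → ℕ
prodUV u v zero    = 1
prodUV u v (suc n) = prodUV u v n * (u (suc n) * v (suc n))

-- x_1 = u_1, x_j = u_j ∏_{k=1}^{j-1} u_k v_k for j ≥ 2
-- (for j = 1 the formula gives u_1 * (empty product) = u_1 as well)
xSeq : (ℕ → ℕ) → (ℕ → ℕ) → ℕ → ℕ
xSeq u v zero    = u zero
xSeq u v (suc n) = u (suc n) * prodUV u v n

-- Strong Engel property: z_j = x_j / x_{j-1}^2 is an integer for all j ≥ 2,
-- i.e. x_{j-1}^2 divides x_j; written with i = j - 1 ≥ 1.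
StrongEngel : (ℕ → ℕ) → Set
StrongEngel x = ∀ i → 1 ≤ i → (x i ^ 2) ∣ x (suc i)

module Submission where

-- Write x = xSeq u v, so that x₁ = u₁ and, for every n,
--     x_{n+2} = u_{n+2} · x_{n+1} · v_{n+1}.
-- By this recursion, x_{n+1}² divides x_{n+2} as soon as x_{n+1} divides
-- u_{n+2}; so the strong Engel property reduces to the divisibilities
-- x_{n+1} ∣ u_{n+2} for all n ≥ 0, which we establish by induction on n
-- for each of the two recurrences.
--   (ii) u_{n+2} = α_n u_{n+1}² v_n:  from x_{n+1} ∣ u_{n+2} we get
--        x_{n+2} = u_{n+2} x_{n+1} v_{n+1} ∣ u_{n+2}² v_{n+1} ∣ u_{n+3}.
--   (i)  u_{n+2} u_n = α_n u_{n+1}³ v_{n+1}:  here the induction needs the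
--        stronger invariant x_{n+1} · u_{n+1} v_{n+1} ∣ u_{n+2}; multiplying
--        the next instance by u_{n+1} it becomes a consequence of the
--        recurrence, and u_{n+1} > 0 is then cancelled.

open import Defs
open import Data.Nat using (ℕ; zero; suc; _*_; _^_; _≤_; _<_; s≤s; z≤n; >-nonZero)
open import Data.Nat.Divisibility
  using (_∣_; divides; ∣-trans; m∣m*n; n∣m*n; *-monoˡ-∣; *-monoʳ-∣; *-cancelˡ-∣; module ∣-Reasoning)
open import Data.Nat.Properties using (*-comm)
open import Data.Nat.Solver using (module +-*-Solver)
open import Data.Product using (_×_; _,_)
open import Data.Sum using (_⊎_; inj₁; inj₂)
open import Relation.Binary.PropositionalEquality using (_≡_; refl; sym; trans; cong)
open +-*-Solver using (solve; _:*_; _:^_; _:=_; con)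

module _ (u v : ℕ → ℕ) where

  private
    x : ℕ → ℕ
    x = xSeq u v

  x-step : ∀ n → x (suc (suc n)) ≡ u (suc (suc n)) * x (suc n) * v (suc n)
  x-step n = rearrange (u (suc (suc n))) (u (suc n)) (prodUV u v n) (v (suc n))
    where
    rearrange : ∀ c a p w → c * (p * (a * w)) ≡ c * (a * p) * w
    rearrange = solve 4 (λ c a p w → c :* (p :* (a :* w)) := c :* (a :* p) :* w) refl

  engel-step : ∀ n → x (suc n) ∣ u (suc (suc n)) → x (suc n) ^ 2 ∣ x (suc (suc n))
  engel-step n x∣u = begin
    x (suc n) ^ 2                              ≡⟨ square (x (suc n)) ⟩
    x (suc n) * x (suc n)                      ∣⟨ *-monoˡ-∣ (x (suc n)) x∣u ⟩
    u (suc (suc n)) * x (suc n)                ∣⟨ m∣m*n (v (suc n)) ⟩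
    u (suc (suc n)) * x (suc n) * v (suc n)    ≡⟨ sym (x-step n) ⟩
    x (suc (suc n))                            ∎
    where
    open ∣-Reasoning
    square : ∀ a → a ^ 2 ≡ a * a
    square = solve 1 (λ a → a :^ 2 := a :* a) refl

  strongEngel-from-divisibility : (∀ n → x (suc n) ∣ u (suc (suc n))) → StrongEngel x
  strongEngel-from-divisibility x∣u (suc n) _ = engel-step n (x∣u n)

  divisibility-ii : (α : ℕ → ℕ) (m : ℕ) →
    (∀ n → 1 ≤ n → u (suc (suc n)) ≡ α n * u (suc n) ^ 2 * v n) → u 2 ≡ m * u 1 →
    ∀ n → x (suc n) ∣ u (suc (suc n))
  divisibility-ii α m rec u₂ zero = divides m (trans u₂ (sym (unit m (u 1))))
    where
    unit : ∀ m a → m * (a * 1) ≡ m * a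
    unit = solve 2 (λ m a → m :* (a :* con 1) := m :* a) refl
  divisibility-ii α m rec u₂ (suc n) = begin
    x (suc (suc n))                                    ≡⟨ x-step n ⟩
    b * x (suc n) * v (suc n)                          ∣⟨ *-monoˡ-∣ (v (suc n)) (*-monoʳ-∣ b ih) ⟩
    b * b * v (suc n)                                  ≡⟨ sym (square-times b (v (suc n))) ⟩
    b ^ 2 * v (suc n)                                  ∣⟨ *-monoˡ-∣ (v (suc n)) (n∣m*n (α (suc n))) ⟩
    α (suc n) * b ^ 2 * v (suc n)                      ≡⟨ sym (rec (suc n) (s≤s z≤n)) ⟩
    u (suc (suc (suc n)))                              ∎
    where
    open ∣-Reasoning
    b : ℕ
    b = u (suc (suc n))
    ih : x (suc n) ∣ b
    ih = divisibility-ii α m rec u₂ n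
    square-times : ∀ a w → a ^ 2 * w ≡ a * a * w
    square-times = solve 2 (λ a w → a :^ 2 :* w := a :* a :* w) refl

  -- Positivity of
  -- u is needed to cancel the factor u_{n+1} in the recurrence.
  invariant-i : (α : ℕ → ℕ) (m : ℕ) → (∀ n → 1 ≤ n → 0 < u n) →
    (∀ n → 1 ≤ n → u (suc (suc n)) * u n ≡ α n * u (suc n) ^ 3 * v (suc n)) →
    u 2 ≡ m * u 1 ^ 2 * v 1 →
    ∀ n → x (suc n) * (u (suc n) * v (suc n)) ∣ u (suc (suc n))
  invariant-i α m pos rec u₂ zero = divides m (trans u₂ (regroup m (u 1) (v 1)))
    where
    regroup : ∀ m a w → m * a ^ 2 * w ≡ m * (a * 1 * (a * w))
    regroup = solve 3 (λ m a w → m :* a :^ 2 :* w := m :* (a :* con 1 :* (a :* w))) refl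
  invariant-i α m pos rec u₂ (suc n) =
    *-cancelˡ-∣ a {{>-nonZero (pos (suc n) (s≤s z≤n))}} (begin
      a * (x (suc (suc n)) * (b * w))                  ≡⟨ cong (λ t → a * (t * (b * w))) (x-step n) ⟩
      a * (b * x (suc n) * v (suc n) * (b * w))        ≡⟨ regroup a b (x (suc n)) (v (suc n)) w ⟩
      b * (x (suc n) * (a * v (suc n))) * (b * w)      ∣⟨ *-monoˡ-∣ (b * w) (*-monoʳ-∣ b ih) ⟩
      b * b * (b * w)                                  ≡⟨ cube-times b w ⟩
      b ^ 3 * w                                        ∣⟨ *-monoˡ-∣ w (n∣m*n (α (suc n))) ⟩
      α (suc n) * b ^ 3 * w                            ≡⟨ sym (rec (suc n) (s≤s z≤n)) ⟩
      u (suc (suc (suc n))) * a                        ≡⟨ *-comm (u (suc (suc (suc n)))) a ⟩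
      a * u (suc (suc (suc n)))                        ∎)
    where
    open ∣-Reasoning
    a b w : ℕ
    a = u (suc n)
    b = u (suc (suc n))
    w = v (suc (suc n))
    ih : x (suc n) * (a * v (suc n)) ∣ b
    ih = invariant-i α m pos rec u₂ n
    regroup : ∀ a b y v w → a * (b * y * v * (b * w)) ≡ b * (y * (a * v)) * (b * w)
    regroup = solve 5 (λ a b y v w → a :* (b :* y :* v :* (b :* w)) := b :* (y :* (a :* v)) :* (b :* w)) refl
    cube-times : ∀ b w → b * b * (b * w) ≡ b ^ 3 * w
    cube-times = solve 2 (λ b w → b :* b :* (b :* w) := b :^ 3 :* w) refl

  divisibility-i : (α : ℕ → ℕ) (m : ℕ) → (∀ n → 1 ≤ n → 0 < u n) →
    (∀ n → 1 ≤ n → u (suc (suc n)) * u n ≡ α n * u (suc n) ^ 3 * v (suc n)) →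
    u 2 ≡ m * u 1 ^ 2 * v 1 →
    ∀ n → x (suc n) ∣ u (suc (suc n))
  divisibility-i α m pos rec u₂ n =
    ∣-trans (m∣m*n (u (suc n) * v (suc n))) (invariant-i α m pos rec u₂ n)

proposition3p1 : (u v α : ℕ → ℕ) (m : ℕ) →
    (∀ n → 1 ≤ n → 0 < u n) → (∀ n → 1 ≤ n → 0 < v n) → (∀ n → 1 ≤ n → 0 < α n) → 0 < m →
    (((∀ n → 1 ≤ n → u (suc (suc n)) * u n ≡ α n * u (suc n) ^ 3 * v (suc n)) × (u 2 ≡ m * u 1 ^ 2 * v 1))
    ⊎ ((∀ n → 1 ≤ n → u (suc (suc n)) ≡ α n * u (suc n) ^ 2 * v n) × (u 2 ≡ m * u 1))) →
    StrongEngel (xSeq u v)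
proposition3p1 u v α m u-pos _ _ _ (inj₁ (rec , u₂)) =
  strongEngel-from-divisibility u v (divisibility-i u v α m u-pos rec u₂)
proposition3p1 u v α m _ _ _ _ (inj₂ (rec , u₂)) =
  strongEngel-from-divisibility u v (divisibility-ii u v α m rec u₂)
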